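{- Let $\lambda=(\lambda_1,\lambda_2,\dots,\lambda_k)\vdash n$ (a partition with at most $k$ parts, $\lambda_1\ge\dots\ge\lambda_k\ge0$). Then \[\frac{1}{k!}\prod_{i=1}^k(\lambda_i+1)\le r_\lambda\le\prod_{i=1}^k(\lambda_i+1),\] where $r_\lambda$ is the number of partitions $\alpha$ (including the empty one) whose Young diagram is contained in that of $\lambda$. -}

module Defs where

open import Data.Nat using (ℕ; zero; suc; _≤_; _≤?_; _*_)
open import Data.Nat.Properties using (≤-refl)
open import Data.Vec using (Vec; []; _∷_; lookup)
open import Data.Fin using (Fin; zero; suc)
open import Data.List using (List; []; _∷_; map; concatMap; upTo; filter; length)
open import Relation.Unary using (Decidable)
open import Relation.Nullary using (Dec; yes; no)
open import Relation.Nullary.Decidable using (_×-dec_)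
open import Data.Unit using (⊤; tt)
open import Data.Product using (_×_)

-- A weakly decreasing vector (parts may be 0): a₁ ≥ a₂ ≥ … ≥ a_k ≥ 0.
-- A partition with at most k parts is represented by such a vector
-- (padded with zeros).
IsDecreasing : ∀ {k} → Vec ℕ k → Set
IsDecreasing [] = ⊤
IsDecreasing (a ∷ []) = ⊤
IsDecreasing (a ∷ b ∷ v) = (b ≤ a) × IsDecreasing (b ∷ v)

isDecreasing? : ∀ {k} → Decidable (IsDecreasing {k})
isDecreasing? [] = yes tt
isDecreasing? (a ∷ []) = yes tt
isDecreasing? (a ∷ b ∷ v) = (b ≤? a) ×-dec isDecreasing? (b ∷ v)

box : ∀ {k} → Vec ℕ k → List (Vec ℕ k)
box [] = [] ∷ []
box (l ∷ ls) = concatMap (λ a → map (a ∷_) (box ls)) (upTo (suc l))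

-- r_λ: the number of partitions α (including the empty one) whose Young
-- diagram is contained in that of λ.  Such α have at most k parts, so they
-- are exactly the weakly decreasing α ∈ ℕ^k with α_i ≤ λ_i for all i.
r : ∀ {k} → Vec ℕ k → ℕ
r lam = length (filter isDecreasing? (box lam))

prodSuc : ∀ {k} → Vec ℕ k → ℕ
prodSuc [] = 1
prodSuc (l ∷ ls) = suc l * prodSuc ls

{-# OPTIONS --safe #-}
module Submission where

-- Write P_m(μ) = ∏ (1 + min(m, μ_i)) and c_m(μ) for the number of partitions
-- inside μ with first part at most m, so that P_{λ₁}(λ) = ∏ (λ_i + 1) and
-- c_{λ₁}(λ) ≤ r_λ.  We show P_m(λ) ≤ k! c_m(λ) by induction on k.  Sorting the
-- partitions inside λ = (λ₁, λ') by their first part a ≤ M = min(m, λ₁) gives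
-- c_m(λ) ≥ Σ_{a ≤ M} c_a(λ').  Since P_a(λ') / (a+1)^(k-1) is non-increasing in
-- a and Σ_{a ≤ M} (a+1)^(k-1) ≥ (M+1)^k / k, the average of P_a(λ') over a ≤ M
-- is at least P_M(λ') / k, hence
--   P_m(λ) = (M+1) P_M(λ') ≤ k Σ_{a ≤ M} P_a(λ') ≤ k! Σ_{a ≤ M} c_a(λ') ≤ k! c_m(λ).
-- The upper bound holds because the partitions inside λ are among the
-- ∏ (λ_i + 1) vectors of the box below λ.

open import Defs
open import Algebra.Properties.CommutativeSemigroup using (x∙yz≈y∙xz)
open import Data.Bool using (true; false)
open import Data.List using (List; []; _∷_; _++_; map; concatMap; applyUpTo; upTo; filter; length)
open import Data.List.Properties using (length-++; length-filter; filter-++; length-map)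
open import Data.List.Relation.Binary.Sublist.Heterogeneous.Properties using (length-mono-≤)
open import Data.List.Relation.Binary.Sublist.Propositional using (⊆-refl)
open import Data.List.Relation.Binary.Sublist.Propositional.Properties using (filter⁺)
open import Data.Nat using (ℕ; zero; suc; _≤_; _<_; _*_; _+_; _^_; _⊓_; z≤n; s≤s; z<s)
open import Data.Nat.Base using (_!)
open import Data.Nat.Properties
open import Data.Nat.Tactic.RingSolver using (solve-∀)
open import Data.Product using (_×_; _,_)
open import Data.Sum using (inj₁; inj₂)
open import Data.Unit using (tt)
open import Data.Vec using (Vec; []; _∷_)
import Data.Vec as Vec
open import Data.Vec.Relation.Unary.All as All using (All; []; _∷_)
open import Function using (_∘_; id)
open import Relation.Binary.PropositionalEquality
open import Relation.Nullary using (Dec; does)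
open import Relation.Unary using (Decidable; Pred)

private variable
  A B : Set

∑< : ℕ → (ℕ → ℕ) → ℕ
∑< zero f = 0
∑< (suc n) f = f 0 + ∑< n (f ∘ suc)

∑<-last : ∀ n f → ∑< (suc n) f ≡ ∑< n f + f n
∑<-last zero f = +-comm (f 0) 0
∑<-last (suc n) f = trans (cong (f 0 +_) (∑<-last n (f ∘ suc))) (sym (+-assoc (f 0) _ _))

∑<-cong : ∀ n {f g} → (∀ a → f a ≡ g a) → ∑< n f ≡ ∑< n g
∑<-cong zero f≗g = refl
∑<-cong (suc n) f≗g = cong₂ _+_ (f≗g 0) (∑<-cong n (f≗g ∘ suc))

∑<-mono-≤ : ∀ n {f g} → (∀ a → a < n → f a ≤ g a) → ∑< n f ≤ ∑< n g
∑<-mono-≤ zero f≤g = z≤n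
∑<-mono-≤ (suc n) f≤g =
  +-mono-≤ (f≤g 0 z<s) (∑<-mono-≤ n (λ a a<n → f≤g (suc a) (s≤s a<n)))

∑<-monoˡ-≤ : ∀ f {m n} → m ≤ n → ∑< m f ≤ ∑< n f
∑<-monoˡ-≤ f z≤n = z≤n
∑<-monoˡ-≤ f (s≤s m≤n) = +-monoʳ-≤ (f 0) (∑<-monoˡ-≤ (f ∘ suc) m≤n)

∑<-const : ∀ n c → ∑< n (λ _ → c) ≡ n * c
∑<-const zero c = refl
∑<-const (suc n) c = cong (c +_) (∑<-const n c)

*-distribˡ-∑< : ∀ c n f → c * ∑< n f ≡ ∑< n (λ a → c * f a)
*-distribˡ-∑< c zero f = *-zeroʳ c
*-distribˡ-∑< c (suc n) f =
  trans (*-distribˡ-+ c (f 0) _) (cong (c * f 0 +_) (*-distribˡ-∑< c n (f ∘ suc)))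

*-distribʳ-∑< : ∀ c n f → ∑< n f * c ≡ ∑< n (λ a → f a * c)
*-distribʳ-∑< c n f = begin
  ∑< n f * c              ≡⟨ *-comm (∑< n f) c ⟩
  c * ∑< n f              ≡⟨ *-distribˡ-∑< c n f ⟩
  ∑< n (λ a → c * f a)    ≡⟨ ∑<-cong n (λ a → *-comm c (f a)) ⟩
  ∑< n (λ a → f a * c)    ∎
  where open ≡-Reasoning

length-filter-mono : ∀ {p q} {P : Pred A p} {Q : Pred A q} (P? : Decidable P) (Q? : Decidable Q) →
                     (∀ {x} → P x → Q x) → ∀ xs → length (filter P? xs) ≤ length (filter Q? xs)
length-filter-mono P? Q? P⇒Q xs = length-mono-≤ (filter⁺ P? Q? (λ { refl → P⇒Q }) (⊆-refl {x = xs}))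

length-filter-map : ∀ {p} {P : Pred B p} (P? : Decidable P) (f : A → B) xs →
                    length (filter P? (map f xs)) ≡ length (filter (P? ∘ f) xs)
length-filter-map P? f [] = refl
length-filter-map P? f (x ∷ xs) with does (P? (f x))
... | true = cong suc (length-filter-map P? f xs)
... | false = length-filter-map P? f xs

filter-concatMap : ∀ {p} {P : Pred B p} (P? : Decidable P) (g : A → List B) xs →
                   filter P? (concatMap g xs) ≡ concatMap (filter P? ∘ g) xs
filter-concatMap P? g [] = refl
filter-concatMap P? g (x ∷ xs) =
  trans (filter-++ P? (g x) (concatMap g xs)) (cong (filter P? (g x) ++_) (filter-concatMap P? g xs))

length-concatMap-applyUpTo : ∀ (g : ℕ → List A) h n →
                             length (concatMap g (applyUpTo h n)) ≡ ∑< n (length ∘ g ∘ h)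
length-concatMap-applyUpTo g h zero = refl
length-concatMap-applyUpTo g h (suc n) =
  trans (length-++ (g (h 0))) (cong (length (g (h 0)) +_) (length-concatMap-applyUpTo g (h ∘ suc) n))

[1+x]^[1+n]≤x^[1+n]+[1+n]*[1+x]^n : ∀ x n → suc x ^ suc n ≤ x ^ suc n + suc n * suc x ^ n
[1+x]^[1+n]≤x^[1+n]+[1+n]*[1+x]^n x zero = ≤-reflexive (+-comm 1 (x * 1))
[1+x]^[1+n]≤x^[1+n]+[1+n]*[1+x]^n x (suc n) = begin
  suc x * suc x ^ suc n
    ≤⟨ *-monoʳ-≤ (suc x) ([1+x]^[1+n]≤x^[1+n]+[1+n]*[1+x]^n x n) ⟩
  suc x * (x ^ suc n + suc n * suc x ^ n)
    ≡⟨ expand x (x ^ suc n) (suc n) (suc x ^ n) ⟩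
  x ^ suc (suc n) + (x ^ suc n + suc n * suc x ^ suc n)
    ≤⟨ +-monoʳ-≤ (x ^ suc (suc n)) (+-monoˡ-≤ (suc n * suc x ^ suc n) (^-monoˡ-≤ (suc n) (n≤1+n x))) ⟩
  x ^ suc (suc n) + (suc x ^ suc n + suc n * suc x ^ suc n)
    ∎
  where
  open ≤-Reasoning
  expand : ∀ x X s Z → suc x * (X + s * Z) ≡ x * X + (X + s * (suc x * Z))
  expand = solve-∀

^-suc≤*∑<-^ : ∀ k N → N ^ suc k ≤ suc k * ∑< N (λ a → suc a ^ k)
^-suc≤*∑<-^ k zero = z≤n
^-suc≤*∑<-^ k (suc n) = begin
  suc n ^ suc k                 ≤⟨ [1+x]^[1+n]≤x^[1+n]+[1+n]*[1+x]^n n k ⟩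
  n ^ suc k + suc k * f n       ≤⟨ +-monoˡ-≤ (suc k * f n) (^-suc≤*∑<-^ k n) ⟩
  suc k * ∑< n f + suc k * f n  ≡⟨ *-distribˡ-+ (suc k) (∑< n f) (f n) ⟨
  suc k * (∑< n f + f n)        ≡⟨ cong (suc k *_) (∑<-last n f) ⟨
  suc k * ∑< (suc n) f          ∎
  where
  open ≤-Reasoning
  f : ℕ → ℕ
  f a = suc a ^ k

capped : ∀ {k} → ℕ → Vec ℕ k → Vec ℕ k
capped m = Vec.map (m ⊓_)

capped-id : ∀ {k m} {v : Vec ℕ k} → All (_≤ m) v → capped m v ≡ v
capped-id [] = refl
capped-id (x≤m ∷ v≤m) = cong₂ _∷_ (m≥n⇒m⊓n≡n x≤m) (capped-id v≤m)

capped-⊓ : ∀ {k} m {l} {v : Vec ℕ k} → All (_≤ l) v → capped (m ⊓ l) v ≡ capped m v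
capped-⊓ m [] = refl
capped-⊓ m {l} {x ∷ v} (x≤l ∷ v≤l) = cong₂ _∷_ m⊓l⊓x≡m⊓x (capped-⊓ m v≤l)
  where
  m⊓l⊓x≡m⊓x : m ⊓ l ⊓ x ≡ m ⊓ x
  m⊓l⊓x≡m⊓x = trans (⊓-assoc m l x) (cong (m ⊓_) (m≥n⇒m⊓n≡n x≤l))

[1+a]*[1+L⊓x]≤[1+L]*[1+a⊓x] : ∀ {a L} x → a ≤ L → suc a * suc (L ⊓ x) ≤ suc L * suc (a ⊓ x)
[1+a]*[1+L⊓x]≤[1+L]*[1+a⊓x] {a} {L} x a≤L with ≤-total x a
... | inj₁ x≤a rewrite m≥n⇒m⊓n≡n x≤a | m≥n⇒m⊓n≡n (≤-trans x≤a a≤L) = *-monoˡ-≤ (suc x) (s≤s a≤L)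
... | inj₂ a≤x rewrite m≤n⇒m⊓n≡m a≤x = begin
  suc a * suc (L ⊓ x)  ≤⟨ *-monoʳ-≤ (suc a) (s≤s (m⊓n≤m L x)) ⟩
  suc a * suc L        ≡⟨ *-comm (suc a) (suc L) ⟩
  suc L * suc a        ∎
  where open ≤-Reasoning

prodSuc-capped-ratio : ∀ {k a L} (v : Vec ℕ k) → a ≤ L →
                       suc a ^ k * prodSuc (capped L v) ≤ suc L ^ k * prodSuc (capped a v)
prodSuc-capped-ratio [] a≤L = ≤-refl
prodSuc-capped-ratio {suc k} {a} {L} (x ∷ v) a≤L = begin
  (suc a * suc a ^ k) * (suc (L ⊓ x) * P L)
    ≡⟨ [m*n]*[o*p]≡[m*o]*[n*p] (suc a) (suc a ^ k) (suc (L ⊓ x)) (P L) ⟩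
  (suc a * suc (L ⊓ x)) * (suc a ^ k * P L)
    ≤⟨ *-mono-≤ ([1+a]*[1+L⊓x]≤[1+L]*[1+a⊓x] x a≤L) (prodSuc-capped-ratio v a≤L) ⟩
  (suc L * suc (a ⊓ x)) * (suc L ^ k * P a)
    ≡⟨ [m*n]*[o*p]≡[m*o]*[n*p] (suc L) (suc L ^ k) (suc (a ⊓ x)) (P a) ⟨
  (suc L * suc L ^ k) * (suc (a ⊓ x) * P a)
    ∎
  where
  open ≤-Reasoning
  P : ℕ → ℕ
  P m = prodSuc (capped m v)

prodSuc-capped-average : ∀ {k} M (v : Vec ℕ k) →
                         suc M * prodSuc (capped M v) ≤ suc k * ∑< (suc M) (λ a → prodSuc (capped a v))
prodSuc-capped-average {k} M v = *-cancelˡ-≤ (suc M ^ k) {{m^n≢0 (suc M) k}} (begin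
  suc M ^ k * (suc M * P M)               ≡⟨ x∙yz≈y∙xz *-commutativeSemigroup (suc M ^ k) (suc M) (P M) ⟩
  suc M * (suc M ^ k * P M)               ≡⟨ *-assoc (suc M) (suc M ^ k) (P M) ⟨
  suc M ^ suc k * P M                     ≤⟨ *-monoˡ-≤ (P M) (^-suc≤*∑<-^ k (suc M)) ⟩
  (suc k * ∑< (suc M) f) * P M            ≡⟨ *-assoc (suc k) (∑< (suc M) f) (P M) ⟩
  suc k * (∑< (suc M) f * P M)            ≡⟨ cong (suc k *_) (*-distribʳ-∑< (P M) (suc M) f) ⟩
  suc k * ∑< (suc M) (λ a → f a * P M)    ≤⟨ *-monoʳ-≤ (suc k) (∑<-mono-≤ (suc M) ratio) ⟩
  suc k * ∑< (suc M) (λ a → suc M ^ k * P a)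
                                          ≡⟨ cong (suc k *_) (*-distribˡ-∑< (suc M ^ k) (suc M) P) ⟨
  suc k * (suc M ^ k * ∑< (suc M) P)      ≡⟨ x∙yz≈y∙xz *-commutativeSemigroup (suc k) (suc M ^ k) (∑< (suc M) P) ⟩
  suc M ^ k * (suc k * ∑< (suc M) P)      ∎)
  where
  open ≤-Reasoning
  P : ℕ → ℕ
  P a = prodSuc (capped a v)
  f : ℕ → ℕ
  f a = suc a ^ k
  ratio : ∀ a → a < suc M → f a * P M ≤ suc M ^ k * P a
  ratio a (s≤s a≤M) = prodSuc-capped-ratio v a≤M

IsDecreasing-tail : ∀ {k} l {v : Vec ℕ k} → IsDecreasing (l ∷ v) → IsDecreasing v
IsDecreasing-tail l {[]} _ = tt
IsDecreasing-tail l {b ∷ v} (_ , d) = d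

IsDecreasing⇒All≤head : ∀ {k} l {v : Vec ℕ k} → IsDecreasing (l ∷ v) → All (_≤ l) v
IsDecreasing⇒All≤head l {[]} _ = []
IsDecreasing⇒All≤head l {b ∷ v} (b≤l , d) =
  b≤l ∷ All.map (λ x≤b → ≤-trans x≤b b≤l) (IsDecreasing⇒All≤head b d)

length-box : ∀ {k} (v : Vec ℕ k) → length (box v) ≡ prodSuc v
length-box [] = refl
length-box (l ∷ ls) = begin
  length (box (l ∷ ls))                            ≡⟨ length-concatMap-applyUpTo column id (suc l) ⟩
  ∑< (suc l) (length ∘ column)                     ≡⟨ ∑<-cong (suc l) length-column ⟩
  ∑< (suc l) (λ _ → prodSuc ls)                    ≡⟨ ∑<-const (suc l) (prodSuc ls) ⟩
  suc l * prodSuc ls                               ∎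
  where
  open ≡-Reasoning
  column : ℕ → List (Vec ℕ _)
  column a = map (a ∷_) (box ls)
  length-column : ∀ a → length (column a) ≡ prodSuc ls
  length-column a = trans (length-map (a ∷_) (box ls)) (length-box ls)

r≤prodSuc : ∀ {k} (v : Vec ℕ k) → r v ≤ prodSuc v
r≤prodSuc v = ≤-trans (length-filter isDecreasing? (box v)) (≤-reflexive (length-box v))

-- IsDecreasing (m ∷ β) says that β is a partition with first part at most m.
rCapped : ∀ {k} → ℕ → Vec ℕ k → ℕ
rCapped m v = length (filter (isDecreasing? ∘ (m ∷_)) (box v))

rCapped≤r : ∀ {k} m (v : Vec ℕ k) → rCapped m v ≤ r v
rCapped≤r m v = length-filter-mono (isDecreasing? ∘ (m ∷_)) isDecreasing? (IsDecreasing-tail m) (box v)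

∑<-rCapped≤rCapped : ∀ {k} m l (ls : Vec ℕ k) →
                     ∑< (suc (m ⊓ l)) (λ a → rCapped a ls) ≤ rCapped m (l ∷ ls)
∑<-rCapped≤rCapped {k} m l ls = begin
  ∑< (suc (m ⊓ l)) (λ a → rCapped a ls)  ≤⟨ ∑<-mono-≤ (suc (m ⊓ l)) rCapped≤slice ⟩
  ∑< (suc (m ⊓ l)) slice                 ≤⟨ ∑<-monoˡ-≤ slice (s≤s (m⊓n≤n m l)) ⟩
  ∑< (suc l) slice                       ≡⟨ length-concatMap-applyUpTo (filter P? ∘ column) id (suc l) ⟨
  length (concatMap (filter P? ∘ column) (upTo (suc l)))
                                         ≡⟨ cong length (filter-concatMap P? column (upTo (suc l))) ⟨
  rCapped m (l ∷ ls)                     ∎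
  where
  open ≤-Reasoning
  P? : (β : Vec ℕ (suc k)) → Dec (IsDecreasing (m ∷ β))
  P? = isDecreasing? ∘ (m ∷_)
  column : ℕ → List (Vec ℕ (suc k))
  column a = map (a ∷_) (box ls)
  slice : ℕ → ℕ
  slice a = length (filter P? (column a))
  rCapped≤slice : ∀ a → a < suc (m ⊓ l) → rCapped a ls ≤ slice a
  rCapped≤slice a (s≤s a≤m⊓l) = ≤-trans
    (length-filter-mono (isDecreasing? ∘ (a ∷_)) (P? ∘ (a ∷_)) (≤-trans a≤m⊓l (m⊓n≤m m l) ,_) (box ls))
    (≤-reflexive (sym (length-filter-map P? (a ∷_) (box ls))))

prodSuc-capped≤!*rCapped : ∀ {k} (v : Vec ℕ k) → IsDecreasing v →
                           ∀ m → prodSuc (capped m v) ≤ k ! * rCapped m v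
prodSuc-capped≤!*rCapped [] _ m = ≤-refl
prodSuc-capped≤!*rCapped {suc k} (l ∷ ls) d m = begin
  suc M * prodSuc (capped m ls)
    ≡⟨ cong (λ w → suc M * prodSuc w) (capped-⊓ m (IsDecreasing⇒All≤head l d)) ⟨
  suc M * prodSuc (capped M ls)
    ≤⟨ prodSuc-capped-average M ls ⟩
  suc k * ∑< (suc M) (λ a → prodSuc (capped a ls))
    ≤⟨ *-monoʳ-≤ (suc k) (∑<-mono-≤ (suc M) (λ a _ → prodSuc-capped≤!*rCapped ls (IsDecreasing-tail l d) a)) ⟩
  suc k * ∑< (suc M) (λ a → k ! * rCapped a ls)
    ≡⟨ cong (suc k *_) (*-distribˡ-∑< (k !) (suc M) (λ a → rCapped a ls)) ⟨
  suc k * (k ! * ∑< (suc M) (λ a → rCapped a ls))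
    ≡⟨ *-assoc (suc k) (k !) (∑< (suc M) (λ a → rCapped a ls)) ⟨
  suc k ! * ∑< (suc M) (λ a → rCapped a ls)
    ≤⟨ *-monoʳ-≤ (suc k !) (∑<-rCapped≤rCapped m l ls) ⟩
  suc k ! * rCapped m (l ∷ ls)
    ∎
  where
  open ≤-Reasoning
  M : ℕ
  M = m ⊓ l

prodSuc≤!*r : ∀ {k} (v : Vec ℕ k) → IsDecreasing v → prodSuc v ≤ k ! * r v
prodSuc≤!*r [] _ = ≤-refl
prodSuc≤!*r {suc k} (l ∷ ls) d = begin
  prodSuc (l ∷ ls)              ≡⟨ cong prodSuc (capped-id (≤-refl ∷ IsDecreasing⇒All≤head l d)) ⟨
  prodSuc (capped l (l ∷ ls))   ≤⟨ prodSuc-capped≤!*rCapped (l ∷ ls) d l ⟩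
  suc k ! * rCapped l (l ∷ ls)  ≤⟨ *-monoʳ-≤ (suc k !) (rCapped≤r l (l ∷ ls)) ⟩
  suc k ! * r (l ∷ ls)          ∎
  where open ≤-Reasoning

lemma11 : (k : ℕ) (lam : Vec ℕ k) → IsDecreasing lam →
          (prodSuc lam ≤ (k !) * r lam) × (r lam ≤ prodSuc lam)
lemma11 k lam d = prodSuc≤!*r lam d , r≤prodSuc lam
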